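{- Let $D$ be a loose multipartite tournament. If $C_{1,2}(D)$ has an asteroidal triple, then the triple is contained in a partite set $X$ of $D$, and $X$ is the only partite set of $D$ that is not $\{1,2\}$-competing.
   Context: All graphs and digraphs are finite and simple. For a digraph $D$, $d_D(x,y)$ is the length of a shortest directed path from $x$ to $y$. The $(1,2)$-step competition graph $C_{1,2}(D)$ is the graph on $V(D)$ in which distinct $u,v$ are adjacent iff there is a vertex $w\notin\{u,v\}$ with either $d_{D-v}(u,w)\le 1$ and $d_{D-u}(v,w)\le 2$, or $d_{D-u}(v,w)\le 1$ and $d_{D-v}(u,w)\le 2$. A multipartite tournament is an orientation of a complete $k$-partite graph for some $k\ge3$ (with nonempty partite sets). A set of vertices is $\{1,2\}$-competing if it is a clique in $C_{1,2}(D)$. A multipartite tournament is loose if some partite set is not $\{1,2\}$-competing. An asteroidal triple of a graph is a set of three vertices such that each two of them are joined by a path avoiding the closed neighborhood of the third. -}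

module Defs where

open import Data.Nat using (ℕ; zero; suc; _≤_)
open import Data.Fin using (Fin)
open import Data.Product using (Σ; ∃; _×_; _,_)
open import Data.Sum using (_⊎_)
open import Relation.Nullary using (¬_)
open import Relation.Binary.PropositionalEquality using (_≡_; _≢_)

-- A finite simple digraph on vertex set Fin n: an arc relation without loops.
-- (No 2-cycles is imposed by the multipartite-tournament condition below.)
record Digraph (n : ℕ) : Set₁ where
  field
    Arc   : Fin n → Fin n → Set
    irrefl : ∀ u → ¬ Arc u u
open Digraph public

record MultipartiteTournament (n k : ℕ) : Set₁ where
  field
    D        : Digraph n
    three≤k  : 3 ≤ k
    part     : Fin n → Fin k
    nonempty : ∀ (i : Fin k) → ∃ λ v → part v ≡ i
    noArcInside : ∀ u v → part u ≡ part v → ¬ Arc D u v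
    arcBetween  : ∀ u v → part u ≢ part v → Arc D u v ⊎ Arc D v u
    antisym     : ∀ u v → ¬ (Arc D u v × Arc D v u)
open MultipartiteTournament public

-- WalkAvoid D r m u w : there is a directed walk of length ≤ m from u to w
-- in D - r (no vertex of the walk equals r).  Hence
-- d_{D-r}(u,w) ≤ m  iff  WalkAvoid D r m u w  (with u, w ≠ r).
data WalkAvoid {n : ℕ} (D : Digraph n) (r : Fin n) : ℕ → Fin n → Fin n → Set where
  here : ∀ {m u} → u ≢ r → WalkAvoid D r m u u
  step : ∀ {m u v w} → u ≢ r → Arc D u v → WalkAvoid D r m v w →
         WalkAvoid D r (suc m) u w

DistLe : ∀ {n} → Digraph n → (r : Fin n) → Fin n → Fin n → ℕ → Set
DistLe D r u w m = WalkAvoid D r m u w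

C12 : ∀ {n} → Digraph n → Fin n → Fin n → Set
C12 D u v =
  u ≢ v ×
  (∃ λ w → w ≢ u × w ≢ v ×
     ((DistLe D v u w 1 × DistLe D u v w 2) ⊎
      (DistLe D u v w 1 × DistLe D v u w 2)))

InClosedNbhd : ∀ {n} → (Fin n → Fin n → Set) → Fin n → Fin n → Set
InClosedNbhd G z v = v ≡ z ⊎ G z v

data PathAvoiding {n : ℕ} (G : Fin n → Fin n → Set) (z : Fin n) : Fin n → Fin n → Set where
  here : ∀ {x} → ¬ InClosedNbhd G z x → PathAvoiding G z x x
  step : ∀ {x y w} → ¬ InClosedNbhd G z x → G x y → PathAvoiding G z y w →
         PathAvoiding G z x w

AsteroidalTriple : ∀ {n} → (Fin n → Fin n → Set) → Fin n → Fin n → Fin n → Set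
AsteroidalTriple G x y z =
  x ≢ y × y ≢ z × x ≢ z ×
  PathAvoiding G z x y × PathAvoiding G x y z × PathAvoiding G y x z

Competing : ∀ {n k} → MultipartiteTournament n k → Fin k → Set
Competing T i = ∀ u v → part T u ≡ i → part T v ≡ i → u ≢ v → C12 (D T) u v

Loose : ∀ {n k} → MultipartiteTournament n k → Set
Loose {k = k} T = ∃ λ (i : Fin k) → ¬ Competing T i

{-# OPTIONS --safe #-}
-- In a loose multipartite tournament, an arc u ⟶ v between vertices that do not
-- (1,2)-compete, with v not a sink, makes v the only out-neighbour of u: an arc between
-- any other out-neighbour of u and an out-neighbour of v would make u and v compete, so
-- all these vertices share a partite set, and then every partite set is {1,2}-competing.
-- The vertices of an asteroidal triple of C₁,₂(D) are pairwise non-adjacent, and each has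
-- a neighbour outside the closed neighbourhood of each of the other two (in particular none
-- is a sink).  Using the sole out-neighbour property this excludes every way of spreading
-- the triple over two or three partite sets: two out-arcs from one vertex of the triple, a
-- directed triangle, or a 2-path v ⟶ w ⟶ u with u, v in one partite set.  So the triple
-- lies in one partite set X, which is not competing as it contains non-adjacent vertices.
-- Two vertices p, q of any other partite set compete: otherwise each of x, y, z has an arc
-- to p or to q, and two of them share that out-neighbour.
module Submission where

open import Defs
open import Data.Nat using (ℕ; suc)
open import Data.Fin using (Fin; _≟_)
open import Data.Product using (∃; _×_; _,_; proj₁; proj₂)
open import Data.Sum using (_⊎_; inj₁; inj₂)
open import Data.Empty using (⊥; ⊥-elim)
open import Relation.Nullary using (¬_; Dec; yes; no)
open import Relation.Binary.Definitions using (Symmetric)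
open import Relation.Binary.PropositionalEquality
  using (_≡_; _≢_; refl; sym; trans; subst; ≢-sym)

Escapes : ∀ {n} → (Fin n → Fin n → Set) → Fin n → Fin n → Set
Escapes G r p = ¬ InClosedNbhd G r p × ∃ λ c → G p c × ¬ InClosedNbhd G r c

module GraphProperties {n : ℕ} (G : Fin n → Fin n → Set) {r : Fin n} where

  ∉N⇒≢ : ∀ {p} → ¬ InClosedNbhd G r p → p ≢ r
  ∉N⇒≢ p∉N[r] p≡r = p∉N[r] (inj₁ p≡r)

  ∉N⇒≁ : ∀ {p} → ¬ InClosedNbhd G r p → ¬ G r p
  ∉N⇒≁ p∉N[r] r∼p = p∉N[r] (inj₂ r∼p)

  Escapes⇒¬N⊆N[r] : ∀ {p} → Escapes G r p → ¬ (∀ {c} → G p c → c ≢ r → G r c)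
  Escapes⇒¬N⊆N[r] (_ , _ , p∼c , c∉N[r]) N⊆N[r] =
    ∉N⇒≁ c∉N[r] (N⊆N[r] p∼c (∉N⇒≢ c∉N[r]))

  PathAvoiding-start : ∀ {a b} → PathAvoiding G r a b → ¬ InClosedNbhd G r a
  PathAvoiding-start (here a∉N[r])     = a∉N[r]
  PathAvoiding-start (step a∉N[r] _ _) = a∉N[r]

  PathAvoiding-end : ∀ {a b} → PathAvoiding G r a b → ¬ InClosedNbhd G r b
  PathAvoiding-end (here b∉N[r])   = b∉N[r]
  PathAvoiding-end (step _ _ path) = PathAvoiding-end path

  PathAvoiding-snoc : ∀ {a b c} → PathAvoiding G r a b → G b c → ¬ InClosedNbhd G r c →
                      PathAvoiding G r a c
  PathAvoiding-snoc (here a∉N[r]) a∼c c∉N[r] = step a∉N[r] a∼c (here c∉N[r])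
  PathAvoiding-snoc (step a∉N[r] a∼d path) b∼c c∉N[r] =
    step a∉N[r] a∼d (PathAvoiding-snoc path b∼c c∉N[r])

  PathAvoiding-reverse : Symmetric G → ∀ {a b} → PathAvoiding G r a b → PathAvoiding G r b a
  PathAvoiding-reverse G-sym (here a∉N[r]) = here a∉N[r]
  PathAvoiding-reverse G-sym (step a∉N[r] a∼c path) =
    PathAvoiding-snoc (PathAvoiding-reverse G-sym path) (G-sym a∼c) a∉N[r]

  PathAvoiding⇒startEscapes : ∀ {a b} → PathAvoiding G r a b → a ≢ b → Escapes G r a
  PathAvoiding⇒startEscapes (here _) a≢a = ⊥-elim (a≢a refl)
  PathAvoiding⇒startEscapes (step a∉N[r] a∼c path) _ =
    a∉N[r] , _ , a∼c , PathAvoiding-start path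

  PathAvoiding⇒endEscapes : Symmetric G → ∀ {a b} → PathAvoiding G r a b → a ≢ b →
                            Escapes G r b
  PathAvoiding⇒endEscapes G-sym path a≢b =
    PathAvoiding⇒startEscapes (PathAvoiding-reverse G-sym path) (≢-sym a≢b)

module DigraphProperties {n : ℕ} (D : Digraph n) where

  arc⇒≢ : ∀ {u v} → Arc D u v → u ≢ v
  arc⇒≢ {u} u⟶u refl = irrefl D u u⟶u

  arc⇒walk : ∀ {r m u w} → u ≢ r → Arc D u w → w ≢ r → WalkAvoid D r (suc m) u w
  arc⇒walk u≢r u⟶w w≢r = step u≢r u⟶w (here w≢r)

  arcs⇒walk : ∀ {r m u s w} → u ≢ r → Arc D u s → s ≢ r → Arc D s w → w ≢ r →
              WalkAvoid D r (suc (suc m)) u w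
  arcs⇒walk u≢r u⟶s s≢r s⟶w w≢r = step u≢r u⟶s (arc⇒walk s≢r s⟶w w≢r)

  C12-sym : Symmetric (C12 D)
  C12-sym (u≢v , w , w≢u , w≢v , inj₁ walks) = ≢-sym u≢v , w , w≢v , w≢u , inj₂ walks
  C12-sym (u≢v , w , w≢u , w≢v , inj₂ walks) = ≢-sym u≢v , w , w≢v , w≢u , inj₁ walks

  commonOutNeighbour⇒C12 : ∀ {u v w} → u ≢ v → Arc D u w → Arc D v w → C12 D u v
  commonOutNeighbour⇒C12 u≢v u⟶w v⟶w =
    u≢v , _ , w≢u , w≢v , inj₁ (arc⇒walk u≢v u⟶w w≢v , arc⇒walk (≢-sym u≢v) v⟶w w≢u)
    where
    w≢u = ≢-sym (arc⇒≢ u⟶w)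
    w≢v = ≢-sym (arc⇒≢ v⟶w)

  arc-and-2path⇒C12 : ∀ {u v s w} → u ≢ v → Arc D u w → Arc D v s → s ≢ u → Arc D s w →
                      w ≢ v → C12 D u v
  arc-and-2path⇒C12 u≢v u⟶w v⟶s s≢u s⟶w w≢v =
    u≢v , _ , w≢u , w≢v ,
    inj₁ (arc⇒walk u≢v u⟶w w≢v , arcs⇒walk (≢-sym u≢v) v⟶s s≢u s⟶w w≢u)
    where
    w≢u = ≢-sym (arc⇒≢ u⟶w)

  C12⇒outArc : ∀ {u v} → C12 D u v → ∃ (Arc D u)
  C12⇒outArc (_ , _ , w≢u , _ , inj₁ (here _ , _))    = ⊥-elim (w≢u refl)
  C12⇒outArc (_ , _ , _ , _ , inj₁ (step _ u⟶s _ , _)) = _ , u⟶s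
  C12⇒outArc (_ , _ , w≢u , _ , inj₂ (_ , here _))    = ⊥-elim (w≢u refl)
  C12⇒outArc (_ , _ , _ , _ , inj₂ (_ , step _ u⟶s _)) = _ , u⟶s

module _ {n k : ℕ} (T : MultipartiteTournament n k) where

  private
    V : Set
    V = Fin n

    infix 4 _⟶_ _∼_

    _⟶_ : V → V → Set
    _⟶_ = Arc (D T)

    _∼_ : V → V → Set
    _∼_ = C12 (D T)

  open DigraphProperties (D T)
  open GraphProperties _∼_

  NonSink : V → Set
  NonSink v = ∃ (v ⟶_)

  OnlyOutNeighbour : V → V → Set
  OnlyOutNeighbour u v = ∀ {t} → u ⟶ t → t ≡ v

  arc⇒partsDiffer : ∀ {u v} → u ⟶ v → part T u ≢ part T v
  arc⇒partsDiffer {u} {v} u⟶v u≈v = noArcInside T u v u≈v u⟶v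

  arc-asym : ∀ {u v} → u ⟶ v → ¬ v ⟶ u
  arc-asym u⟶v v⟶u = antisym T _ _ (u⟶v , v⟶u)

  noArcs⇒samePart : ∀ {u v} → ¬ u ⟶ v → ¬ v ⟶ u → part T u ≡ part T v
  noArcs⇒samePart {u} {v} u↛v v↛u with part T u ≟ part T v
  ... | yes u≈v = u≈v
  ... | no u≉v with arcBetween T u v u≉v
  ...   | inj₁ u⟶v = ⊥-elim (u↛v u⟶v)
  ...   | inj₂ v⟶u = ⊥-elim (v↛u v⟶u)

  onlyOutNeighbour⇒arcInto : ∀ {w u t} → OnlyOutNeighbour w u → t ≢ u → part T t ≢ part T w →
                             t ⟶ w
  onlyOutNeighbour⇒arcInto {w} {t = t} onlyU t≢u t≉w with arcBetween T t w t≉w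
  ... | inj₁ t⟶w = t⟶w
  ... | inj₂ w⟶t = ⊥-elim (t≢u (onlyU w⟶t))

  escapes⇒nonSink : ∀ {r p} → Escapes _∼_ r p → NonSink p
  escapes⇒nonSink (_ , _ , p∼c , _) = C12⇒outArc p∼c

  ∉N⇒¬commonOutNeighbour : ∀ {s t o} → ¬ InClosedNbhd _∼_ s t → s ⟶ o → t ⟶ o → ⊥
  ∉N⇒¬commonOutNeighbour t∉N[s] s⟶o t⟶o =
    ∉N⇒≁ t∉N[s] (commonOutNeighbour⇒C12 (≢-sym (∉N⇒≢ t∉N[s])) s⟶o t⟶o)

  module SecondOutNeighbour {u v a b : V} (u⟶v : u ⟶ v) (u≁v : ¬ u ∼ v) (v⟶b : v ⟶ b)
                            (u⟶a : u ⟶ a) (a≢v : a ≢ v) where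

    u≢v : u ≢ v
    u≢v = arc⇒≢ u⟶v

    outNeighbourOfV⇒≢u : ∀ {t} → v ⟶ t → t ≢ u
    outNeighbourOfV⇒≢u v⟶u refl = arc-asym u⟶v v⟶u

    outNeighbours⇒samePart : ∀ {a′ b′} → u ⟶ a′ → a′ ≢ v → v ⟶ b′ → part T a′ ≡ part T b′
    outNeighbours⇒samePart {a′} {b′} u⟶a′ a′≢v v⟶b′ = noArcs⇒samePart a′↛b′ b′↛a′
      where
      b′≢u = outNeighbourOfV⇒≢u v⟶b′

      a′↛b′ : ¬ a′ ⟶ b′
      a′↛b′ a′⟶b′ =
        u≁v (C12-sym (arc-and-2path⇒C12 (≢-sym u≢v) v⟶b′ u⟶a′ a′≢v a′⟶b′ b′≢u))

      b′↛a′ : ¬ b′ ⟶ a′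
      b′↛a′ b′⟶a′ = u≁v (arc-and-2path⇒C12 u≢v u⟶a′ v⟶b′ b′≢u b′⟶a′ a′≢v)

    outNeighbourOfV⇒notInPartOfU : ∀ {p} → v ⟶ p → part T p ≢ part T u
    outNeighbourOfV⇒notInPartOfU v⟶p p≈u =
      arc⇒partsDiffer u⟶a (sym (trans (outNeighbours⇒samePart u⟶a a≢v v⟶p) p≈u))

    outNeighbourOfU⇒arcToV : ∀ {p} → u ⟶ p → p ≢ v → p ⟶ v
    outNeighbourOfU⇒arcToV {p} u⟶p p≢v with arcBetween T p v p≉v
      where
      p≉v : part T p ≢ part T v
      p≉v p≈v = arc⇒partsDiffer v⟶b (trans (sym p≈v) (outNeighbours⇒samePart u⟶p p≢v v⟶b))
    ... | inj₁ p⟶v = p⟶v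
    ... | inj₂ v⟶p = ⊥-elim (u≁v (commonOutNeighbour⇒C12 u≢v u⟶p v⟶p))

    arcIntoUOrV : ∀ {p} → p ≢ v → p ⟶ u ⊎ p ⟶ v
    arcIntoUOrV {p} p≢v with part T p ≟ part T u
    ... | yes p≈u with arcBetween T p v (λ p≈v → arc⇒partsDiffer u⟶v (trans (sym p≈u) p≈v))
    ...   | inj₁ p⟶v = inj₂ p⟶v
    ...   | inj₂ v⟶p = ⊥-elim (outNeighbourOfV⇒notInPartOfU v⟶p p≈u)
    arcIntoUOrV {p} p≢v | no p≉u with arcBetween T p u p≉u
    ...   | inj₁ p⟶u = inj₁ p⟶u
    ...   | inj₂ u⟶p = inj₂ (outNeighbourOfU⇒arcToV u⟶p p≢v)

    b⟶u : b ⟶ u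
    b⟶u with arcIntoUOrV (≢-sym (arc⇒≢ v⟶b))
    ... | inj₁ arc = arc
    ... | inj₂ b⟶v = ⊥-elim (arc-asym v⟶b b⟶v)

    samePartAsV⇒∼v : ∀ {q} → part T q ≡ part T v → q ≢ v → q ∼ v
    samePartAsV⇒∼v {q} q≈v q≢v with arcIntoUOrV q≢v
    ... | inj₁ q⟶u = arc-and-2path⇒C12 q≢v q⟶u v⟶b b≢q b⟶u u≢v
      where
      b≢q : b ≢ q
      b≢q refl = arc⇒partsDiffer v⟶b (sym q≈v)
    ... | inj₂ q⟶v = ⊥-elim (arc⇒partsDiffer q⟶v q≈v)

    samePart⇒∼ : ∀ {p q} → part T p ≡ part T q → p ≢ q → p ∼ q
    samePart⇒∼ {p} {q} p≈q p≢q with p ≟ v | q ≟ v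
    ... | yes refl | _ = C12-sym (samePartAsV⇒∼v (sym p≈q) (≢-sym p≢q))
    ... | no _ | yes refl = samePartAsV⇒∼v p≈q p≢q
    ... | no p≢v | no q≢v with arcIntoUOrV p≢v | arcIntoUOrV q≢v
    ...   | inj₁ p⟶u | inj₁ q⟶u = commonOutNeighbour⇒C12 p≢q p⟶u q⟶u
    ...   | inj₂ p⟶v | inj₂ q⟶v = commonOutNeighbour⇒C12 p≢q p⟶v q⟶v
    ...   | inj₁ p⟶u | inj₂ q⟶v = C12-sym (arc-and-2path⇒C12 (≢-sym p≢q) q⟶v p⟶u
                                     (λ { refl → arc⇒partsDiffer p⟶u p≈q }) u⟶v (≢-sym p≢v))
    ...   | inj₂ p⟶v | inj₁ q⟶u = arc-and-2path⇒C12 p≢q p⟶v q⟶u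
                                     (λ { refl → arc⇒partsDiffer q⟶u (sym p≈q) }) u⟶v (≢-sym q≢v)

    allCompeting : ∀ i → Competing T i
    allCompeting i p q p∈i q∈i = samePart⇒∼ (trans p∈i (sym q∈i))

  module _ {u v w : V} (u≈v : part T u ≡ part T v) (v⟶w : v ⟶ w) (w⟶u : w ⟶ u)
           (onlyU : OnlyOutNeighbour w u) where

    private
      u≢v : u ≢ v
      u≢v refl = arc-asym v⟶w w⟶u

      arcIntoU⇒∼v : ∀ {a} → a ⟶ u → a ≢ v → a ≢ w → a ∼ v
      arcIntoU⇒∼v a⟶u a≢v a≢w = arc-and-2path⇒C12 a≢v a⟶u v⟶w (≢-sym a≢w) w⟶u u≢v

      -- a reaches w in at most two steps avoiding v, and v ⟶ w.
      arcAwayFromUV⇒∼v : ∀ {a s} → a ⟶ s → s ≢ u → s ≢ v → a ≢ u → a ≢ v → a ≢ w → a ∼ v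
      arcAwayFromUV⇒∼v {a} {s} a⟶s s≢u s≢v a≢u a≢v a≢w =
        a≢v , w , ≢-sym a≢w , w≢v , inj₂ (arc⇒walk (≢-sym a≢v) v⟶w (≢-sym a≢w) , a⇝w)
        where
        w≢v = ≢-sym (arc⇒≢ v⟶w)

        a⇝w : WalkAvoid (D T) v 2 a w
        a⇝w with part T s ≟ part T w
        ... | no s≉w = arcs⇒walk a≢v a⟶s s≢v (onlyOutNeighbour⇒arcInto onlyU s≢u s≉w) w≢v
        ... | yes s≈w = arc⇒walk a≢v (onlyOutNeighbour⇒arcInto onlyU a≢u a≉w) w≢v
          where
          a≉w : part T a ≢ part T w
          a≉w a≈w = arc⇒partsDiffer a⟶s (trans a≈w (sym s≈w))

    -- Every walk out of w passes through u, so a competes with w at u or at an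
    -- out-neighbour of u.
    ∼w⇒∼v : ∀ {a} → a ≢ u → a ≢ v → a ∼ w → a ∼ v
    ∼w⇒∼v _ _ (_ , _ , m≢a , _ , inj₁ (here _ , _)) = ⊥-elim (m≢a refl)
    ∼w⇒∼v _ _ (_ , _ , _ , m≢w , inj₁ (step _ _ (here _) , here _)) = ⊥-elim (m≢w refl)
    ∼w⇒∼v _ a≢v (a≢w , _ , _ , _ , inj₁ (step _ a⟶m (here _) , step _ w⟶m (here _)))
      with onlyU w⟶m
    ... | refl = arcIntoU⇒∼v a⟶m a≢v a≢w
    ∼w⇒∼v a≢u a≢v
      (a≢w , _ , _ , _ , inj₁ (step _ a⟶m (here _) , step _ w⟶s (step _ s⟶m (here _))))
      with onlyU w⟶s
    ... | refl = arcAwayFromUV⇒∼v a⟶m (≢-sym (arc⇒≢ s⟶m))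
                   (λ { refl → arc⇒partsDiffer s⟶m u≈v }) a≢u a≢v a≢w
    ∼w⇒∼v _ _ (_ , _ , _ , m≢w , inj₂ (here _ , _)) = ⊥-elim (m≢w refl)
    ∼w⇒∼v a≢u a≢v (a≢w , _ , _ , _ , inj₂ (step _ w⟶m (here _) , a⇝m))
      with onlyU w⟶m | a⇝m
    ... | refl | here _ = ⊥-elim (a≢u refl)
    ... | refl | step _ a⟶u (here _) = arcIntoU⇒∼v a⟶u a≢v a≢w
    ... | refl | step _ a⟶s (step _ s⟶u (here _)) =
      arcAwayFromUV⇒∼v a⟶s (arc⇒≢ s⟶u) (λ { refl → arc⇒partsDiffer s⟶u (sym u≈v) })
        a≢u a≢v a≢w

  ∼middleOfCycle : ∀ {u v w} → u ⟶ v → v ⟶ w → w ⟶ u →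
                   OnlyOutNeighbour u v → OnlyOutNeighbour w u →
                   ∀ {c} → c ≢ u → c ≢ v → c ≢ w → c ∼ v
  ∼middleOfCycle {u} {w = w} u⟶v v⟶w w⟶u onlyV onlyU {c} c≢u c≢v c≢w with part T c ≟ part T u
  ... | no c≉u = arc-and-2path⇒C12 c≢v (onlyOutNeighbour⇒arcInto onlyV c≢v c≉u) v⟶w
                   (≢-sym c≢w) w⟶u (arc⇒≢ u⟶v)
  ... | yes c≈u = commonOutNeighbour⇒C12 c≢v (onlyOutNeighbour⇒arcInto onlyU c≢u c≉w) v⟶w
    where
    c≉w : part T c ≢ part T w
    c≉w c≈w = arc⇒partsDiffer w⟶u (trans (sym c≈w) c≈u)

  competingAwayFromIndependentTriple :
    ∀ (Y : Fin k) {x y z} → Y ≢ part T x → Y ≢ part T y → Y ≢ part T z →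
    ¬ InClosedNbhd _∼_ x y → ¬ InClosedNbhd _∼_ x z → ¬ InClosedNbhd _∼_ y z → Competing T Y
  competingAwayFromIndependentTriple Y {x} {y} {z} Y≢x Y≢y Y≢z y∉N[x] z∉N[x] z∉N[y]
                                     p q p∈Y q∈Y p≢q =
    adjacentOrPigeonhole (adjacentOrInto Y≢x) (adjacentOrInto Y≢y) (adjacentOrInto Y≢z)
    where
    Into : V → Set
    Into s = s ⟶ p ⊎ s ⟶ q

    adjacentOrInto : ∀ {s} → Y ≢ part T s → p ∼ q ⊎ Into s
    adjacentOrInto {s} Y≢s
      with arcBetween T p s (λ p≈s → Y≢s (trans (sym p∈Y) p≈s))
         | arcBetween T q s (λ q≈s → Y≢s (trans (sym q∈Y) q≈s))
    ... | inj₁ p⟶s | inj₁ q⟶s = inj₁ (commonOutNeighbour⇒C12 p≢q p⟶s q⟶s)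
    ... | inj₂ s⟶p | _        = inj₂ (inj₁ s⟶p)
    ... | inj₁ _   | inj₂ s⟶q = inj₂ (inj₂ s⟶q)

    pigeonhole : Into x → Into y → Into z → ⊥
    pigeonhole (inj₁ x⟶p) (inj₁ y⟶p) _          = ∉N⇒¬commonOutNeighbour y∉N[x] x⟶p y⟶p
    pigeonhole (inj₂ x⟶q) (inj₂ y⟶q) _          = ∉N⇒¬commonOutNeighbour y∉N[x] x⟶q y⟶q
    pigeonhole (inj₁ x⟶p) (inj₂ _)   (inj₁ z⟶p) = ∉N⇒¬commonOutNeighbour z∉N[x] x⟶p z⟶p
    pigeonhole (inj₁ _)   (inj₂ y⟶q) (inj₂ z⟶q) = ∉N⇒¬commonOutNeighbour z∉N[y] y⟶q z⟶q
    pigeonhole (inj₂ _)   (inj₁ y⟶p) (inj₁ z⟶p) = ∉N⇒¬commonOutNeighbour z∉N[y] y⟶p z⟶p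
    pigeonhole (inj₂ x⟶q) (inj₁ _)   (inj₂ z⟶q) = ∉N⇒¬commonOutNeighbour z∉N[x] x⟶q z⟶q

    adjacentOrPigeonhole : p ∼ q ⊎ Into x → p ∼ q ⊎ Into y → p ∼ q ⊎ Into z → p ∼ q
    adjacentOrPigeonhole (inj₁ p∼q) _ _ = p∼q
    adjacentOrPigeonhole _ (inj₁ p∼q) _ = p∼q
    adjacentOrPigeonhole _ _ (inj₁ p∼q) = p∼q
    adjacentOrPigeonhole (inj₂ x⟶) (inj₂ y⟶) (inj₂ z⟶) = ⊥-elim (pigeonhole x⟶ y⟶ z⟶)

  module _ (loose : Loose T) where

    onlyOutNeighbour : ∀ {u v} → u ⟶ v → ¬ u ∼ v → NonSink v → OnlyOutNeighbour u v
    onlyOutNeighbour {v = v} u⟶v u≁v (_ , v⟶b) {a} u⟶a with a ≟ v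
    ... | yes a≡v = a≡v
    ... | no a≢v = ⊥-elim (proj₂ loose
                     (SecondOutNeighbour.allCompeting u⟶v u≁v v⟶b u⟶a a≢v (proj₁ loose)))

    private
      onlyOutNeighbourOfEscapes : ∀ {u v} → u ⟶ v → Escapes _∼_ u v → OnlyOutNeighbour u v
      onlyOutNeighbourOfEscapes u⟶v v∉N[u] =
        onlyOutNeighbour u⟶v (∉N⇒≁ (proj₁ v∉N[u])) (escapes⇒nonSink v∉N[u])

    ¬twoOutArcs : ∀ {u v w} → u ⟶ v → u ⟶ w → w ≢ v → Escapes _∼_ u v → ⊥
    ¬twoOutArcs u⟶v u⟶w w≢v v∉N[u] = w≢v (onlyOutNeighbourOfEscapes u⟶v v∉N[u] u⟶w)

    ¬cyclic : ∀ {u v w} → u ⟶ v → v ⟶ w → w ⟶ u →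
              Escapes _∼_ u v → Escapes _∼_ w u → Escapes _∼_ v u → ⊥
    ¬cyclic {u} {v} {w} u⟶v v⟶w w⟶u v∉N[u] u∉N[w] u∉N[v] =
      Escapes⇒¬N⊆N[r] u∉N[v] v∼neighbourOfU
      where
      v∼neighbourOfU : ∀ {c} → u ∼ c → c ≢ v → v ∼ c
      v∼neighbourOfU u∼c c≢v =
        C12-sym (∼middleOfCycle u⟶v v⟶w w⟶u (onlyOutNeighbourOfEscapes u⟶v v∉N[u])
                  (onlyOutNeighbourOfEscapes w⟶u u∉N[w]) (≢-sym (proj₁ u∼c)) c≢v
                  (λ { refl → ∉N⇒≁ (proj₁ u∉N[w]) (C12-sym u∼c) }))

    ¬twoPathWithinPart : ∀ {u v w} → part T u ≡ part T v → v ⟶ w → w ⟶ u →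
                         Escapes _∼_ w u → Escapes _∼_ v w → ⊥
    ¬twoPathWithinPart {_} {v} {w} u≈v v⟶w w⟶u u∉N[w] w∉N[v] =
      Escapes⇒¬N⊆N[r] w∉N[v] v∼neighbourOfW
      where
      v∼neighbourOfW : ∀ {c} → w ∼ c → c ≢ v → v ∼ c
      v∼neighbourOfW w∼c c≢v =
        C12-sym (∼w⇒∼v u≈v v⟶w w⟶u (onlyOutNeighbourOfEscapes w⟶u u∉N[w])
                  (λ { refl → ∉N⇒≁ (proj₁ u∉N[w]) w∼c }) c≢v (C12-sym w∼c))

    ¬pairWithOutsider : ∀ {u v w} → part T u ≡ part T v → part T w ≢ part T u →
                        Escapes _∼_ u v → Escapes _∼_ w u → Escapes _∼_ w v →
                        Escapes _∼_ u w → Escapes _∼_ v w → ⊥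
    ¬pairWithOutsider {u} {v} {w} u≈v w≉u v∉N[u] u∉N[w] v∉N[w] w∉N[u] w∉N[v]
      with arcBetween T w u w≉u | arcBetween T w v (λ w≈v → w≉u (trans w≈v (sym u≈v)))
    ... | inj₁ w⟶u | inj₁ w⟶v = ¬twoOutArcs w⟶u w⟶v (∉N⇒≢ (proj₁ v∉N[u])) u∉N[w]
    ... | inj₁ w⟶u | inj₂ v⟶w = ¬twoPathWithinPart u≈v v⟶w w⟶u u∉N[w] w∉N[v]
    ... | inj₂ u⟶w | inj₁ w⟶v = ¬twoPathWithinPart (sym u≈v) u⟶w w⟶v v∉N[w] w∉N[u]
    ... | inj₂ u⟶w | inj₂ v⟶w = ∉N⇒¬commonOutNeighbour (proj₁ v∉N[u]) u⟶w v⟶w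

    ¬inThreeParts : ∀ {x y z} → part T x ≢ part T y → part T y ≢ part T z → part T x ≢ part T z →
                    Escapes _∼_ x y → Escapes _∼_ y x → Escapes _∼_ x z → Escapes _∼_ z x →
                    Escapes _∼_ z y → ⊥
    ¬inThreeParts {x} {y} {z} x≉y y≉z x≉z y∉N[x] x∉N[y] z∉N[x] x∉N[z] y∉N[z]
      with arcBetween T x y x≉y | arcBetween T y z y≉z | arcBetween T x z x≉z
    ... | inj₁ x⟶y | _        | inj₁ x⟶z = ¬twoOutArcs x⟶y x⟶z (λ { refl → y≉z refl }) y∉N[x]
    ... | inj₁ x⟶y | inj₁ y⟶z | inj₂ z⟶x = ¬cyclic x⟶y y⟶z z⟶x y∉N[x] x∉N[z] x∉N[y]
    ... | inj₁ x⟶y | inj₂ z⟶y | inj₂ z⟶x = ¬twoOutArcs z⟶y z⟶x (∉N⇒≢ (proj₁ x∉N[y])) y∉N[z]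
    ... | inj₂ y⟶x | inj₁ y⟶z | _        = ¬twoOutArcs y⟶x y⟶z (∉N⇒≢ (proj₁ z∉N[x])) x∉N[y]
    ... | inj₂ y⟶x | inj₂ z⟶y | inj₁ x⟶z = ¬cyclic x⟶z z⟶y y⟶x z∉N[x] x∉N[y] x∉N[z]
    ... | inj₂ y⟶x | inj₂ z⟶y | inj₂ z⟶x = ¬twoOutArcs z⟶y z⟶x (∉N⇒≢ (proj₁ x∉N[y])) y∉N[z]

    asteroidalTriple⇒samePart : ∀ {x y z} → AsteroidalTriple _∼_ x y z →
                                part T y ≡ part T x × part T z ≡ part T x
    asteroidalTriple⇒samePart {x} {y} {z} (x≢y , y≢z , x≢z , avoidN[z] , avoidN[x] , avoidN[y]) =
      bySamePartOrNot (part T y ≟ part T x) (part T z ≟ part T x) (part T z ≟ part T y)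
      where
      x∉N[z] = PathAvoiding⇒startEscapes avoidN[z] x≢y
      y∉N[z] = PathAvoiding⇒endEscapes C12-sym avoidN[z] x≢y
      y∉N[x] = PathAvoiding⇒startEscapes avoidN[x] y≢z
      z∉N[x] = PathAvoiding⇒endEscapes C12-sym avoidN[x] y≢z
      x∉N[y] = PathAvoiding⇒startEscapes avoidN[y] x≢z
      z∉N[y] = PathAvoiding⇒endEscapes C12-sym avoidN[y] x≢z

      bySamePartOrNot : Dec (part T y ≡ part T x) → Dec (part T z ≡ part T x) →
                        Dec (part T z ≡ part T y) → part T y ≡ part T x × part T z ≡ part T x
      bySamePartOrNot (yes y≈x) (yes z≈x) _ = y≈x , z≈x
      bySamePartOrNot (yes y≈x) (no z≉x) _ = ⊥-elim
        (¬pairWithOutsider (sym y≈x) z≉x y∉N[x] x∉N[z] y∉N[z] z∉N[x] z∉N[y])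
      bySamePartOrNot (no y≉x) (yes z≈x) _ = ⊥-elim
        (¬pairWithOutsider (sym z≈x) y≉x z∉N[x] x∉N[y] z∉N[y] y∉N[x] y∉N[z])
      bySamePartOrNot (no y≉x) (no _) (yes z≈y) = ⊥-elim
        (¬pairWithOutsider (sym z≈y) (≢-sym y≉x) z∉N[y] y∉N[x] z∉N[x] x∉N[y] x∉N[z])
      bySamePartOrNot (no y≉x) (no z≉x) (no z≉y) = ⊥-elim
        (¬inThreeParts (≢-sym y≉x) (≢-sym z≉y) (≢-sym z≉x) y∉N[x] x∉N[y] z∉N[x] x∉N[z] y∉N[z])

lemma4p1 : ∀ {n k} (T : MultipartiteTournament n k) → Loose T →
    ∀ x y z → AsteroidalTriple (C12 (D T)) x y z →
    ∃ λ (X : Fin k) →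
      (part T x ≡ X × part T y ≡ X × part T z ≡ X) ×
      ¬ Competing T X × (∀ (Y : Fin k) → Y ≢ X → Competing T Y)
lemma4p1 T loose x y z triple@(x≢y , _ , _ , _ , avoidN[x] , avoidN[y]) =
  part T x , (refl , y∈X , z∈X) , X-notCompeting , othersCompeting
  where
  open GraphProperties (C12 (D T))

  y∈X = proj₁ (asteroidalTriple⇒samePart T loose triple)
  z∈X = proj₂ (asteroidalTriple⇒samePart T loose triple)

  y∉N[x] = PathAvoiding-start avoidN[x]
  z∉N[x] = PathAvoiding-end avoidN[x]
  z∉N[y] = PathAvoiding-end avoidN[y]

  X-notCompeting : ¬ Competing T (part T x)
  X-notCompeting competing = ∉N⇒≁ y∉N[x] (competing x y refl y∈X x≢y)

  othersCompeting : ∀ Y → Y ≢ part T x → Competing T Y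
  othersCompeting Y Y≢X =
    competingAwayFromIndependentTriple T Y Y≢X
      (subst (Y ≢_) (sym y∈X) Y≢X) (subst (Y ≢_) (sym z∈X) Y≢X) y∉N[x] z∉N[x] z∉N[y]
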